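{- Let $\mathbb{T}=(\Sigma,\mathcal{E})$ be a graded theory, $\sigma\in\Sigma$, $\Gamma$ a poset, and $f\colon|\mathrm{ar}(\sigma)|\to\mathsf{T}_{\Sigma,k}(\Gamma)$. Then $\Gamma\vdash_{k+d(\sigma)}{\downarrow}\sigma(f)$ is derivable iff $\Gamma\vdash_k f(i)\le f(j)$ is derivable for all $i\le j$ in $\mathrm{ar}(\sigma)$.
   Context: A graded signature $\Sigma$: sets $\Sigma(P,n)$ of operation symbols for finite posets $P$ and $n\in\omega$; $\mathrm{ar}(\sigma)=P$, $d(\sigma)=n$; $|P|$ is the underlying set. Terms $\mathsf{T}_{\Sigma,k}(\Gamma)$ over a poset $\Gamma$: each $x\in\Gamma$ has depth $0$; for $\sigma\in\Sigma(P,k)$ and any function $f\colon|P|\to\mathsf{T}_{\Sigma,m}(\Gamma)$, $\sigma(f)$ has depth $k+m$. Subterms: $\mathsf{sub}(x)=\{x\}$, $\mathsf{sub}(\sigma(f))=\{\sigma(f)\}\cup\bigcup_i\mathsf{sub}(f(i))$, $\mathsf{sub}(s,t)=\mathsf{sub}(s)\cup\mathsf{sub}(t)$. An inequation $\Gamma\vdash_k s\le t$ is a pair $s,t\in\mathsf{T}_{\Sigma,k}(\Gamma)$; $\Gamma\vdash_k{\downarrow}t$ means $\Gamma\vdash_k t\le t$. A graded theory $\mathbb{T}=(\Sigma,\mathcal{E})$ has a set $\mathcal{E}$ of inequations (axioms). A uniform substitution $\gamma\colon|\Delta|\to\mathsf{T}_{\Sigma,k}(\Gamma)$ extends to $\bar\gamma$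 by $\bar\gamma(x)=\gamma(x)$, $\bar\gamma(\sigma(f))=\sigma(\bar\gamma\cdot f)$. Derivability rules: (Var) $\Gamma\vdash_0 x\le y$ for $x\le y$ in $\Gamma$. (Ar) for $f\colon|\mathrm{ar}(\sigma)|\to\mathsf{T}_{\Sigma,k}(\Gamma)$: from $\Gamma\vdash_k f(i)\le f(j)$ for all $i\le j$ infer $\Gamma\vdash_{k+d(\sigma)}{\downarrow}\sigma(f)$. (Trans) from $\Gamma\vdash_k s\le t$, $\Gamma\vdash_k t\le u$ infer $\Gamma\vdash_k s\le u$. (Mon) for $f,g\colon|\mathrm{ar}(\sigma)|\to\mathsf{T}_{\Sigma,k}(\Gamma)$: from $\Gamma\vdash_k f(i)\le g(i)$ for all $i$, $\Gamma\vdash_{k+d(\sigma)}{\downarrow}\sigma(f)$, $\Gamma\vdash_{k+d(\sigma)}{\downarrow}\sigma(g)$ infer $\Gamma\vdash_{k+d(\sigma)}\sigma(f)\le\sigma(g)$. (Ax1) for an axiom $\Delta\vdash_n s\le t$ and $\gamma\colon|\Delta|\to\mathsf{T}_{\Sigma,k}(\Gamma)$: from $\Gamma\vdash_k\gamma(x)\le\gamma(y)$ for all $x\le y$ in $\Delta$ infer $\Gamma\vdash_{n+k}\bar\gamma(s)\le\bar\gamma(t)$. (Ax2) for an axiom $\Delta\vdash_n s\le t$, $\sigma'(g)\in\mathsf{sub}(s,t)$ with $g\colon|\mathrm{ar}(\sigma')|\to\mathsf{T}_{\Sigma,m}(\Delta)$, $i\le j$ in $\mathrm{ar}(\sigma')$,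 and $\gamma\colon|\Delta|\to\mathsf{T}_{\Sigma,k}(\Gamma)$: from $\Gamma\vdash_k\gamma(x)\le\gamma(y)$ for all $x\le y$ in $\Delta$ infer $\Gamma\vdash_{m+k}\bar\gamma(g(i))\le\bar\gamma(g(j))$. -}

module Defs where

open import Level using (0ℓ)
open import Data.Nat using (ℕ; _+_)
open import Data.Fin using (Fin)
open import Data.Sum using (_⊎_)
open import Relation.Binary.PropositionalEquality using (_≡_)
open import Relation.Binary.Structures using (IsPartialOrder)
open import Relation.Binary.Bundles using (Poset)

record FinPoset : Set₁ where
  field
    size           : ℕ
    _≤_            : Fin size → Fin size → Set
    isPartialOrder : IsPartialOrder _≡_ _≤_

∣_∣ : FinPoset → Set
∣ P ∣ = Fin (FinPoset.size P)

-- A graded signature: the disjoint union of the sets Σ(P,n), packaged as a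
-- type of operation symbols with their arity ar(σ) and depth d(σ).
record Signature : Set₁ where
  field
    Op : Set
    ar : Op → FinPoset
    d  : Op → ℕ

module _ (S : Signature) where
  open Signature S

  data Tm (X : Set) : Set where
    var : X → Tm X
    op  : (σ : Op) → (∣ ar σ ∣ → Tm X) → Tm X

  -- HasDepth n t  :  t ∈ T_{Σ,n}(X).  Variables have depth 0;
  -- σ(f) has depth m + d(σ) when every f(i) has depth m.
  data HasDepth {X : Set} : ℕ → Tm X → Set where
    var : (x : X) → HasDepth 0 (var x)
    op  : {m : ℕ} (σ : Op) (f : ∣ ar σ ∣ → Tm X) →
          (∀ i → HasDepth m (f i)) → HasDepth (m + d σ) (op σ f)

  data _∈sub_ {X : Set} : Tm X → Tm X → Set where
    here  : ∀ {t} → t ∈sub t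
    there : ∀ {u σ f} (i : ∣ ar σ ∣) → u ∈sub f i → u ∈sub op σ f

  subst : {X Y : Set} → (X → Tm Y) → Tm X → Tm Y
  subst γ (var x)  = γ x
  subst γ (op σ f) = op σ (λ i → subst γ (f i))

record Theory : Set₂ where
  field
    sig  : Signature
    Ax   : Set
    ctx  : Ax → Poset 0ℓ 0ℓ 0ℓ
    dep  : Ax → ℕ
    lhs  : (a : Ax) → Tm sig (Poset.Carrier (ctx a))
    rhs  : (a : Ax) → Tm sig (Poset.Carrier (ctx a))
    lhsD : (a : Ax) → HasDepth sig (dep a) (lhs a)
    rhsD : (a : Ax) → HasDepth sig (dep a) (rhs a)

module _ (𝕋 : Theory) where
  open Theory 𝕋
  open Signature sig

  data Der (Γ : Poset 0ℓ 0ℓ 0ℓ) : ℕ → Tm sig (Poset.Carrier Γ) → Tm sig (Poset.Carrier Γ) → Set where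
    Var   : ∀ {x y} → Poset._≤_ Γ x y → Der Γ 0 (var x) (var y)
    Ar    : ∀ {k} (σ : Op) (f : ∣ ar σ ∣ → Tm sig (Poset.Carrier Γ)) →
            (∀ i → HasDepth sig k (f i)) →
            (∀ i j → FinPoset._≤_ (ar σ) i j → Der Γ k (f i) (f j)) →
            Der Γ (k + d σ) (op σ f) (op σ f)
    Trans : ∀ {k s t u} → Der Γ k s t → Der Γ k t u → Der Γ k s u
    Mon   : ∀ {k} (σ : Op) (f g : ∣ ar σ ∣ → Tm sig (Poset.Carrier Γ)) →
            (∀ i → HasDepth sig k (f i)) → (∀ i → HasDepth sig k (g i)) →
            (∀ i → Der Γ k (f i) (g i)) →
            Der Γ (k + d σ) (op σ f) (op σ f) →
            Der Γ (k + d σ) (op σ g) (op σ g) →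
            Der Γ (k + d σ) (op σ f) (op σ g)
    Ax1   : ∀ {k} (a : Ax) (γ : Poset.Carrier (ctx a) → Tm sig (Poset.Carrier Γ)) →
            (∀ x → HasDepth sig k (γ x)) →
            (∀ x y → Poset._≤_ (ctx a) x y → Der Γ k (γ x) (γ y)) →
            Der Γ (dep a + k) (subst sig γ (lhs a)) (subst sig γ (rhs a))
    Ax2   : ∀ {k m} (a : Ax) (σ′ : Op) (g : ∣ ar σ′ ∣ → Tm sig (Poset.Carrier (ctx a))) →
            (∀ i → HasDepth sig m (g i)) →
            (_∈sub_ sig (op σ′ g) (lhs a) ⊎ _∈sub_ sig (op σ′ g) (rhs a)) →
            (i j : ∣ ar σ′ ∣) → FinPoset._≤_ (ar σ′) i j →
            (γ : Poset.Carrier (ctx a) → Tm sig (Poset.Carrier Γ)) →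
            (∀ x → HasDepth sig k (γ x)) →
            (∀ x y → Poset._≤_ (ctx a) x y → Der Γ k (γ x) (γ y)) →
            Der Γ (m + k) (subst sig γ (g i)) (subst sig γ (g j))

{-# OPTIONS --safe #-}
module Submission where

open import Defs
open import Level using (0ℓ)
open import Data.Nat using (ℕ; _+_)
open import Data.Nat.Properties using (+-cancelʳ-≡; +-commutativeSemigroup)
open import Algebra.Properties.CommutativeSemigroup +-commutativeSemigroup using (xy∙z≈xz∙y)
open import Data.Product using (_×_; _,_; proj₁; proj₂)
open import Data.Sum using (_⊎_; inj₁; inj₂)
import Data.Sum as Sum
open import Data.Unit using (⊤; tt)
open import Function.Bundles using (_⇔_; mk⇔)
open import Relation.Binary.Bundles using (Poset)
open import Relation.Binary.PropositionalEquality using (_≡_; refl; trans)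
import Relation.Binary.PropositionalEquality as ≡

-- The converse of (Ar) holds because every rule only ever concludes
-- inequations between terms whose arguments are already derivably ordered:
-- (Ar) and (Mon) by their premises, (Trans) by induction, and (Ax1)/(Ax2)
-- because every compound subterm σ′(g) of an axiom, once substituted, has its
-- argument inequations derivable by (Ax2) itself.  Depths enter only through
-- the cancellation m′ + d σ′ + k = m + d σ′ ⇒ m′ + k = m.

module _ {S : Signature} {X : Set} where

  ∈sub-trans : {u t v : Tm S X} → _∈sub_ S u t → _∈sub_ S t v → _∈sub_ S u v
  ∈sub-trans p here        = p
  ∈sub-trans p (there i q) = there i (∈sub-trans p q)

  ∈sub-trans-⊎ : {u t v w : Tm S X} → _∈sub_ S u t →
                 _∈sub_ S t v ⊎ _∈sub_ S t w → _∈sub_ S u v ⊎ _∈sub_ S u w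
  ∈sub-trans-⊎ p = Sum.map (∈sub-trans p) (∈sub-trans p)

+-cancel-middle : ∀ m′ e k m → m′ + e + k ≡ m + e → m′ + k ≡ m
+-cancel-middle m′ e k m eq = +-cancelʳ-≡ e (m′ + k) m (trans (xy∙z≈xz∙y m′ k e) eq)

module _ (𝕋 : Theory) (Γ : Poset 0ℓ 0ℓ 0ℓ) where
  open Theory 𝕋
  open Signature sig

  private
    C = Poset.Carrier Γ

  ArgsOrdered : ℕ → Tm sig C → Set
  ArgsOrdered n (var x)  = ⊤
  ArgsOrdered n (op σ f) =
    ∀ m → n ≡ m + d σ → ∀ i j → FinPoset._≤_ (ar σ) i j → Der 𝕋 Γ m (f i) (f j)

  subst-argsOrdered : ∀ {k} (a : Ax) (γ : Poset.Carrier (ctx a) → Tm sig C) →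
    (∀ x → HasDepth sig k (γ x)) →
    (∀ x y → Poset._≤_ (ctx a) x y → Der 𝕋 Γ k (γ x) (γ y)) →
    (∀ x → ArgsOrdered k (γ x)) →
    ∀ {n u} → HasDepth sig n u → _∈sub_ sig u (lhs a) ⊎ _∈sub_ sig u (rhs a) →
    ArgsOrdered (n + k) (subst sig γ u)
  subst-argsOrdered a γ γD γ≤ γOrd (var x) _ = γOrd x
  subst-argsOrdered {k} a γ γD γ≤ γOrd (op {m′} σ′ g gD) u∈ m eq i j i≤j =
    ≡.subst (λ n → Der 𝕋 Γ n _ _) (+-cancel-middle m′ (d σ′) k m eq)
      (Ax2 a σ′ g gD u∈ i j i≤j γ γD γ≤)

  Der⇒argsOrdered : ∀ {n s t} → Der 𝕋 Γ n s t → ArgsOrdered n s × ArgsOrdered n t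
  Der⇒argsOrdered (Var _) = tt , tt
  Der⇒argsOrdered (Ar {k} σ f _ f≤) = fOrd , fOrd
    where
    fOrd : ArgsOrdered (k + d σ) (op σ f)
    fOrd m eq i j i≤j = ≡.subst (λ n → Der 𝕋 Γ n _ _) (+-cancelʳ-≡ (d σ) k m eq) (f≤ i j i≤j)
  Der⇒argsOrdered (Trans p q) = proj₁ (Der⇒argsOrdered p) , proj₂ (Der⇒argsOrdered q)
  Der⇒argsOrdered (Mon σ f g _ _ _ pf pg) = proj₁ (Der⇒argsOrdered pf) , proj₁ (Der⇒argsOrdered pg)
  Der⇒argsOrdered (Ax1 a γ γD γ≤) =
    subst-argsOrdered a γ γD γ≤ γOrd (lhsD a) (inj₁ here) ,
    subst-argsOrdered a γ γD γ≤ γOrd (rhsD a) (inj₂ here)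
    where
    γOrd : ∀ x → ArgsOrdered _ (γ x)
    γOrd x = proj₁ (Der⇒argsOrdered (γ≤ x x (Poset.refl (ctx a))))
  Der⇒argsOrdered (Ax2 a σ′ g gD g∈ i j _ γ γD γ≤) =
    subst-argsOrdered a γ γD γ≤ γOrd (gD i) (∈sub-trans-⊎ (there i here) g∈) ,
    subst-argsOrdered a γ γD γ≤ γOrd (gD j) (∈sub-trans-⊎ (there j here) g∈)
    where
    γOrd : ∀ x → ArgsOrdered _ (γ x)
    γOrd x = proj₁ (Der⇒argsOrdered (γ≤ x x (Poset.refl (ctx a))))

mainTheorem6 : (𝕋 : Theory) (σ : Signature.Op (Theory.sig 𝕋)) (Γ : Poset 0ℓ 0ℓ 0ℓ) (k : ℕ)
    (f : ∣ Signature.ar (Theory.sig 𝕋) σ ∣ → Tm (Theory.sig 𝕋) (Poset.Carrier Γ)) →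
    (∀ i → HasDepth (Theory.sig 𝕋) k (f i)) →
    (Der 𝕋 Γ (k + Signature.d (Theory.sig 𝕋) σ) (op σ f) (op σ f)
      ⇔ (∀ i j → FinPoset._≤_ (Signature.ar (Theory.sig 𝕋) σ) i j → Der 𝕋 Γ k (f i) (f j)))
mainTheorem6 𝕋 σ Γ k f fD =
  mk⇔ (λ σf↓ → proj₁ (Der⇒argsOrdered 𝕋 Γ σf↓) k refl) (Ar σ f fD)
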